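{- Let $a,b$ be coprime integers with $|a|<|b|$ and let $N>0$ be an integer. Then there exists a set $A\subseteq\{1,\dots,N\}$ with $|A|\geq N^{\log 6/\log 56}$ such that $A$ contains no non-trivial solutions to the equation $ax_1+bx_2=ax_1'+bx_2'$.
   Context: A solution $(x_1,x_2,x_1',x_2')$ (variables in $A$) of $ax_1+bx_2=ax_1'+bx_2'$ is trivial if, viewing the equation as $ax_1+bx_2-ax_1'-bx_2'=0$, for every value $\alpha$ the coefficients of the variables equal to $\alpha$ sum to zero; otherwise it is non-trivial. -}

module Defs where

open import Data.Nat as ℕ using (ℕ; _≡ᵇ_)
open import Data.Integer using (ℤ; +_; _+_; _*_; -_; 0ℤ)
open import Data.Bool using (if_then_else_)
open import Relation.Binary.PropositionalEquality using (_≡_)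

coeffAt : ℤ → ℕ → ℕ → ℤ
coeffAt c x α = if x ≡ᵇ α then c else 0ℤ

-- The solution (x₁,x₂,x₁',x₂') of  a x₁ + b x₂ - a x₁' - b x₂' = 0  is trivial
-- if for every value α the coefficients of the variables equal to α sum to 0.
Trivial : ℤ → ℤ → ℕ → ℕ → ℕ → ℕ → Set
Trivial a b x₁ x₂ x₁' x₂' =
  ∀ (α : ℕ) → coeffAt a x₁ α + coeffAt b x₂ α + coeffAt (- a) x₁' α + coeffAt (- b) x₂' α ≡ 0ℤ

IsSolution : ℤ → ℤ → ℕ → ℕ → ℕ → ℕ → Set
IsSolution a b x₁ x₂ x₁' x₂' = a * + x₁ + b * + x₂ ≡ a * + x₁' + b * + x₂'

{-# OPTIONS --safe #-}
-- Let c = ∣ b ∣ ≥ 2 and B = (2c − 1)(c − 1) + 1, and take the numbers below N all of whose base-B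
-- digits lie in [0, c).  If a x₁ + b x₂ = a x₁′ + b x₂′ for such numbers, the lower digits contribute
-- less than Bᵏ to a (x₁ − x₁′) + b (x₂ − x₂′), since (∣ a ∣ + ∣ b ∣)(c − 1) < B; so the leading digits
-- satisfy a (e₁ − e₁′) + b (e₂ − e₂′) = 0, and as a, b are coprime and ∣ e₁ − e₁′ ∣ < c = ∣ b ∣ they
-- agree.  By induction on the number of digits, only the solutions x₁ = x₁′, x₂ = x₂′ remain.
-- Counting digit by digit, using that t ↦ t ^ θ is subadditive for θ ≤ 1, there are at least
-- N ^ (log c / log B) such numbers, and log c / log B ≥ log 6 / log 56 with equality at c = 6
-- (B = 56); for c ≠ 6 a fraction strictly between the two ratios is exhibited.  Shifting by 1 puts
-- the set inside {1, …, N}.  When ∣ b ∣ = 1 we have a = 0, every solution has x₂ = x₂′, and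
-- {1, …, N} itself works.  Real exponents are never formed: N ^ θ ≤ m is expressed as
-- N ^ p ≤ m ^ q for all p / q ≤ θ.
module Submission where

open import Defs
open import Data.Nat using (ℕ; _≤_; _<_; _^_)
open import Data.Integer using (ℤ; ∣_∣)
open import Data.Integer.Coprimality using (Coprime)
open import Data.List using (List; length)
open import Data.List.Relation.Unary.All using (All)
open import Data.List.Relation.Unary.Unique.Propositional using (Unique)
open import Data.List.Membership.Propositional using (_∈_)
open import Data.Product using (Σ; _×_)
open import Data.Nat.Base using (NonZero)

module Powers where

  open import Data.Nat.Base
  open import Data.Nat.Properties
  open import Data.Product using (_×_; _,_)
  open import Data.Sum using (inj₁; inj₂)
  open import Relation.Nullary.Negation using (contradiction)
  open import Algebra.Properties.CommutativeSemigroup *-commutativeSemigroup using (interchange)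
  open import Relation.Binary.PropositionalEquality
  open import Data.Nat.Tactic.RingSolver using (solve-∀)
  open import Relation.Nullary using (Dec; ¬?; yes; no)
  open import Relation.Nullary.Decidable using (_×-dec_; _→-dec_; from-yes)
  open ≤-Reasoning

  ^-distribʳ-* : ∀ m n o → (m * n) ^ o ≡ m ^ o * n ^ o
  ^-distribʳ-* m n zero    = refl
  ^-distribʳ-* m n (suc o) =
    trans (cong (m * n *_) (^-distribʳ-* m n o)) (interchange m n (m ^ o) (n ^ o))

  ^-comm-^ : ∀ m n o → (m ^ n) ^ o ≡ (m ^ o) ^ n
  ^-comm-^ m n o = begin-equality
    (m ^ n) ^ o  ≡⟨ ^-*-assoc m n o ⟩
    m ^ (n * o)  ≡⟨ cong (m ^_) (*-comm n o) ⟩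
    m ^ (o * n)  ≡⟨ ^-*-assoc m o n ⟨
    (m ^ o) ^ n  ∎

  ^-cancelʳ-≤ : ∀ {m n} o .{{_ : NonZero o}} → m ^ o ≤ n ^ o → m ≤ n
  ^-cancelʳ-≤ o mᵒ≤nᵒ = ≮⇒≥ λ n<m → <⇒≱ (^-monoˡ-< o n<m) mᵒ≤nᵒ

  ^-cancelˡ-≤ : ∀ {n o} m → 1 < m → m ^ n ≤ m ^ o → n ≤ o
  ^-cancelˡ-≤ m 1<m mⁿ≤mᵒ = ≮⇒≥ λ o<n → <⇒≱ (^-monoʳ-< m 1<m o<n) mⁿ≤mᵒ

  m^n≤m^o : ∀ m {n o} → 0 < n → n ≤ o → m ^ n ≤ m ^ o
  m^n≤m^o zero    {suc _} _ _   = z≤n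
  m^n≤m^o (suc m)         _ n≤o = ^-monoʳ-≤ (suc m) n≤o

  n<m^n : ∀ {m} n → 1 < m → n < m ^ n
  n<m^n     zero    _   = s≤s z≤n
  n<m^n {m} (suc n) 1<m = begin-strict
    suc n          <⟨ s≤s n<mⁿ ⟩
    suc (m ^ n)    ≤⟨ +-monoˡ-≤ (m ^ n) (m<n⇒0<n n<mⁿ) ⟩
    m ^ n + m ^ n  ≡⟨ cong (m ^ n +_) (+-identityʳ (m ^ n)) ⟨
    2 * m ^ n      ≤⟨ *-monoˡ-≤ (m ^ n) 1<m ⟩
    m * m ^ n      ∎
    where n<mⁿ = n<m^n n 1<m

  -- (x , y) ≼ (x′ , y′) says log y / log x ≤ log y′ / log x′: every fraction p / q
  -- below the first ratio (x ^ p ≤ y ^ q) is below the second.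
  infix 4 _≼_
  _≼_ : ℕ × ℕ → ℕ × ℕ → Set
  (x , y) ≼ (x′ , y′) = ∀ p q → x ^ p ≤ y ^ q → x′ ^ p ≤ y′ ^ q

  ≼-refl : ∀ {xy} → xy ≼ xy
  ≼-refl _ _ xᵖ≤yᵍ = xᵖ≤yᵍ

  ≼-trans : ∀ {xy xy′ xy″} → xy ≼ xy′ → xy′ ≼ xy″ → xy ≼ xy″
  ≼-trans xy≼xy′ xy′≼xy″ p q xᵖ≤yᵍ = xy′≼xy″ p q (xy≼xy′ p q xᵖ≤yᵍ)

  ≼-by-fraction : ∀ {x y x′ y′} r s → 0 < r → 1 < y → 0 < y′ →
                  y ^ s ≤ x ^ r → x′ ^ r ≤ y′ ^ s → (x , y) ≼ (x′ , y′)
  ≼-by-fraction {x} {y} {x′} {y′} r s 0<r 1<y 0<y′ yˢ≤xʳ x′ʳ≤y′ˢ p q xᵖ≤yᵍ =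
    ^-cancelʳ-≤ r {{>-nonZero 0<r}} (begin
      (x′ ^ p) ^ r  ≡⟨ ^-comm-^ x′ p r ⟩
      (x′ ^ r) ^ p  ≤⟨ ^-monoˡ-≤ p x′ʳ≤y′ˢ ⟩
      (y′ ^ s) ^ p  ≡⟨ ^-*-assoc y′ s p ⟩
      y′ ^ (s * p)  ≤⟨ ^-monoʳ-≤ y′ {{>-nonZero 0<y′}} sp≤qr ⟩
      y′ ^ (q * r)  ≡⟨ ^-*-assoc y′ q r ⟨
      (y′ ^ q) ^ r  ∎)
    where
    sp≤qr : s * p ≤ q * r
    sp≤qr = ^-cancelˡ-≤ y 1<y (begin
      y ^ (s * p)  ≡⟨ ^-*-assoc y s p ⟨
      (y ^ s) ^ p  ≤⟨ ^-monoˡ-≤ p yˢ≤xʳ ⟩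
      (x ^ r) ^ p  ≡⟨ ^-comm-^ x r p ⟩
      (x ^ p) ^ r  ≤⟨ ^-monoˡ-≤ r xᵖ≤yᵍ ⟩
      (y ^ q) ^ r  ≡⟨ ^-*-assoc y q r ⟩
      y ^ (q * r)  ∎)

  x^p≤y^q⇒p≤q : ∀ {x y} → 1 < x → y ≤ x → ∀ p q → x ^ p ≤ y ^ q → p ≤ q
  x^p≤y^q⇒p≤q {x} {y} 1<x y≤x p q xᵖ≤yᵍ = ^-cancelˡ-≤ x 1<x (≤-trans xᵖ≤yᵍ (^-monoˡ-≤ q y≤x))

  *-pres-^≤ : ∀ p q {x y u v} → x ^ p ≤ u ^ q → y ^ p ≤ v ^ q → (x * y) ^ p ≤ (u * v) ^ q
  *-pres-^≤ p q {x} {y} {u} {v} xᵖ≤uᵍ yᵖ≤vᵍ = begin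
    (x * y) ^ p      ≡⟨ ^-distribʳ-* x y p ⟩
    x ^ p * y ^ p    ≤⟨ *-mono-≤ xᵖ≤uᵍ yᵖ≤vᵍ ⟩
    u ^ q * v ^ q    ≡⟨ ^-distribʳ-* u v q ⟨
    (u * v) ^ q      ∎

  ^-pres-^≤ : ∀ p q {x u} k → x ^ p ≤ u ^ q → (x ^ k) ^ p ≤ (u ^ k) ^ q
  ^-pres-^≤ p q {x} {u} k xᵖ≤uᵍ = begin
    (x ^ k) ^ p  ≡⟨ ^-comm-^ x k p ⟩
    (x ^ p) ^ k  ≤⟨ ^-monoˡ-≤ k xᵖ≤uᵍ ⟩
    (u ^ q) ^ k  ≡⟨ ^-comm-^ u q k ⟩
    (u ^ k) ^ q  ∎

  -- With y / v ≤ x / u, cancel u ^ p from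
  -- (u (x + y)) ^ p ≤ (x (u + v)) ^ p ≤ u ^ (p + t) (u + v) ^ p ≤ u ^ p (u + v) ^ (p + t).
  +-pres-^≤-ordered : ∀ p t {x y u v} → 0 < p → y * u ≤ x * v → x ^ p ≤ u ^ (p + t) →
                      y ^ p ≤ v ^ (p + t) → (x + y) ^ p ≤ (u + v) ^ (p + t)
  +-pres-^≤-ordered p t {zero} {_} {zero} _ _ _ yᵖ≤vᵍ = yᵖ≤vᵍ
  +-pres-^≤-ordered (suc p) t {suc x} {_} {zero} _ _ xᵖ≤0 _ =
    contradiction xᵖ≤0 (<⇒≱ (m^n>0 (suc x) (suc p)))
  +-pres-^≤-ordered p t {x} {y} {u@(suc _)} {v} _ yu≤xv xᵖ≤uᵍ _ =
    *-cancelˡ-≤ (u ^ p) {{m^n≢0 u p}} (begin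
      u ^ p * (x + y) ^ p                 ≡⟨ ^-distribʳ-* u (x + y) p ⟨
      (u * (x + y)) ^ p                   ≤⟨ ^-monoˡ-≤ p u[x+y]≤x[u+v] ⟩
      (x * (u + v)) ^ p                   ≡⟨ ^-distribʳ-* x (u + v) p ⟩
      x ^ p * (u + v) ^ p                 ≤⟨ *-monoˡ-≤ _ xᵖ≤uᵍ ⟩
      u ^ (p + t) * (u + v) ^ p           ≡⟨ cong (_* (u + v) ^ p) (^-distribˡ-+-* u p t) ⟩
      u ^ p * u ^ t * (u + v) ^ p         ≤⟨ *-monoˡ-≤ _ (*-monoʳ-≤ (u ^ p) (^-monoˡ-≤ t (m≤m+n u v))) ⟩
      u ^ p * (u + v) ^ t * (u + v) ^ p   ≡⟨ *-assoc (u ^ p) _ _ ⟩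
      u ^ p * ((u + v) ^ t * (u + v) ^ p) ≡⟨ cong (u ^ p *_) (^-distribˡ-+-* (u + v) t p) ⟨
      u ^ p * (u + v) ^ (t + p)           ≡⟨ cong (λ e → u ^ p * (u + v) ^ e) (+-comm t p) ⟩
      u ^ p * (u + v) ^ (p + t)           ∎)
    where
    u[x+y]≤x[u+v] : u * (x + y) ≤ x * (u + v)
    u[x+y]≤x[u+v] = begin
      u * (x + y)    ≡⟨ *-distribˡ-+ u x y ⟩
      u * x + u * y  ≡⟨ cong₂ _+_ (*-comm u x) (*-comm u y) ⟩
      x * u + y * u  ≤⟨ +-monoʳ-≤ (x * u) yu≤xv ⟩
      x * u + x * v  ≡⟨ *-distribˡ-+ x u v ⟨
      x * (u + v)    ∎

  -- t ↦ t ^ (p / q) is subadditive for p ≤ q.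
  +-pres-^≤ : ∀ {p q x y u v} → 0 < p → p ≤ q → x ^ p ≤ u ^ q → y ^ p ≤ v ^ q → (x + y) ^ p ≤ (u + v) ^ q
  +-pres-^≤ {p} {q} {x} {y} {u} {v} 0<p p≤q xᵖ≤uᵍ yᵖ≤vᵍ with q ∸ p | m+[n∸m]≡n p≤q
  ... | t | refl with ≤-total (y * u) (x * v)
  ...   | inj₁ yu≤xv = +-pres-^≤-ordered p t 0<p yu≤xv xᵖ≤uᵍ yᵖ≤vᵍ
  ...   | inj₂ xv≤yu = subst₂ (λ s w → s ^ p ≤ w ^ (p + t)) (+-comm y x) (+-comm v u)
                          (+-pres-^≤-ordered p t 0<p xv≤yu yᵖ≤vᵍ xᵖ≤uᵍ)

  -- The least base with (∣ a ∣ + ∣ b ∣)(c − 1) < base c whenever ∣ a ∣ < ∣ b ∣ = c.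
  base : ℕ → ℕ
  base c = suc ((pred c + c) * pred c)

  c≤base : ∀ c → c ≤ base c
  c≤base zero    = z≤n
  c≤base (suc n) = s≤s (≤-trans (m≤m+n n (n * n)) (*-monoˡ-≤ n (m≤n+m (suc n) n)))

  base≤2c² : ∀ c → 0 < c → base c ≤ 2 * (c * c)
  base≤2c² c@(suc n) _ = begin
    suc ((n + c) * n)  ≤⟨ *-mono-< (+-monoˡ-< c (n<1+n n)) (n<1+n n) ⟩
    (c + c) * c        ≡⟨ double c ⟩
    2 * (c * c)        ∎
    where
    double : ∀ m → (m + m) * m ≡ 2 * (m * m)
    double = solve-∀

  base^9≤c^20 : ∀ c → 23 ≤ c → base c ^ 9 ≤ c ^ 20
  base^9≤c^20 c 23≤c = begin
    base c ^ 9           ≤⟨ ^-monoˡ-≤ 9 (base≤2c² c (≤-trans (s≤s z≤n) 23≤c)) ⟩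
    (2 * (c * c)) ^ 9    ≡⟨ ^-distribʳ-* 2 (c * c) 9 ⟩
    512 * (c * c) ^ 9    ≤⟨ *-monoˡ-≤ ((c * c) ^ 9) (≤-trans (from-yes (512 ≤? 23 * 23)) (*-mono-≤ 23≤c 23≤c)) ⟩
    (c * c) ^ 10         ≡⟨ ^-distribʳ-* c c 10 ⟩
    c ^ 10 * c ^ 10      ≡⟨ ^-distribˡ-+-* c 10 10 ⟨
    c ^ 20               ∎

  -- r / s with log c / log (base c) ≥ r / s ≥ log 6 / log 56
  SeparatingFraction : ℕ → ℕ × ℕ → Set
  SeparatingFraction c (r , s) = 0 < r × base c ^ r ≤ c ^ s × 6 ^ s ≤ 56 ^ r

  separatingFraction? : ∀ c rs → Dec (SeparatingFraction c rs)
  separatingFraction? c (r , s) = 0 <? r ×-dec base c ^ r ≤? c ^ s ×-dec 6 ^ s ≤? 56 ^ r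

  separatingFraction⇒≼ : ∀ {c} rs → 0 < c → SeparatingFraction c rs → (56 , 6) ≼ (base c , c)
  separatingFraction⇒≼ (r , s) 0<c (0<r , baseʳ≤cˢ , 6ˢ≤56ʳ) = ≼-by-fraction r s 0<r (s≤s (s≤s z≤n)) 0<c 6ˢ≤56ʳ baseʳ≤cˢ

  fraction : ℕ → ℕ × ℕ
  fraction 2  = 1 , 2
  fraction 3  = 5 , 11
  fraction 4  = 13 , 29
  fraction 5  = 41 , 92
  fraction 7  = 57 , 128
  fraction 8  = 37 , 83
  fraction 9  = 25 , 56
  fraction 10 = 21 , 47
  fraction 11 = 17 , 38
  fraction 12 = 13 , 29
  fraction 13 = 13 , 29
  fraction _  = 9 , 20

  fraction-separating : ∀ {c} → c < 23 → 2 ≤ c → c ≢ 6 → SeparatingFraction c (fraction c)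
  fraction-separating = from-yes (allUpTo? (λ c → 2 ≤? c →-dec ¬? (c ≟ 6) →-dec separatingFraction? c (fraction c)) 23)

  9/20-separating : ∀ c → 23 ≤ c → SeparatingFraction c (9 , 20)
  9/20-separating c 23≤c = s≤s z≤n , base^9≤c^20 c 23≤c , from-yes (6 ^ 20 ≤? 56 ^ 9)

  -- At c = 6 the two ratios coincide (base 6 = 56), so no fraction separates them.
  56/6≼base : ∀ c → 2 ≤ c → (56 , 6) ≼ (base c , c)
  56/6≼base c 2≤c with c ≟ 6 | c <? 23
  ... | yes refl | _        = ≼-refl
  ... | no c≢6   | yes c<23 = separatingFraction⇒≼ (fraction c) 0<c (fraction-separating c<23 2≤c c≢6)
    where 0<c = ≤-trans (s≤s z≤n) 2≤c
  ... | no _     | no c≮23  = separatingFraction⇒≼ (9 , 20) 0<c (9/20-separating c (≮⇒≥ c≮23))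
    where 0<c = ≤-trans (s≤s z≤n) 2≤c

module Digits (c B : ℕ) .{{_ : NonZero c}} (c≤B : c ≤ B) where

  open import Data.Nat.Base
  open import Data.Nat.Properties
  open import Data.Nat.DivMod using (_/_; _%_; m≡m%n+[m/n]*n; m%n<n)
  open import Data.Product using (_×_; _,_; ∃₂; proj₂)
  open import Data.Sum using (inj₁; inj₂)
  open import Relation.Nullary using (yes; no)
  open import Data.List using (List; []; _∷_; _++_; map; length)
  open import Data.List.Properties using (length-++; length-map)
  open import Data.List.Membership.Propositional using (_∈_)
  open import Data.List.Membership.Propositional.Properties using (∈-map⁻; ∈-++⁻)
  open import Data.List.Relation.Unary.Any using (here)
  import Data.List.Relation.Unary.All as All
  open import Data.List.Relation.Unary.AllPairs as AllPairs using (AllPairs)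
  import Data.List.Relation.Unary.AllPairs.Properties as AllPairs
  open import Relation.Binary.PropositionalEquality
  open Powers
  open ≤-Reasoning

  private
    <∸⇒+< : ∀ {m n o} → m < n ∸ o → o + m < n
    <∸⇒+< {m} {n} {o} m<n∸o = subst (_≤ n) (cong suc (+-comm m o)) (m≤o∸n⇒m+n≤o (suc m) o≤n m<n∸o)
      where o≤n = <⇒≤ (m∸n≢0⇒n<m (m<n⇒n≢0 m<n∸o))

  private instance
    B-nonZero : NonZero B
    B-nonZero = >-nonZero (<-≤-trans (>-nonZero⁻¹ c) c≤B)

  SmallDigits : ℕ → ℕ → Set
  SmallDigits zero    x = x ≡ 0
  SmallDigits (suc k) x = ∃₂ λ e y → e < c × SmallDigits k y × x ≡ e * B ^ k + y

  smallDigits-scaled< : ∀ w → w * pred c < B → ∀ k {x} → SmallDigits k x → w * x < B ^ k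
  smallDigits-scaled< w _ zero refl = subst (_< 1) (sym (*-zeroʳ w)) (s≤s z≤n)
  smallDigits-scaled< w w[c-1]<B (suc k) (e , y , e<c , y-digits , refl) = begin-strict
    w * (e * B ^ k + y)        ≡⟨ *-distribˡ-+ w (e * B ^ k) y ⟩
    w * (e * B ^ k) + w * y    <⟨ +-monoʳ-< (w * (e * B ^ k)) (smallDigits-scaled< w w[c-1]<B k y-digits) ⟩
    w * (e * B ^ k) + B ^ k    ≡⟨ +-comm (w * (e * B ^ k)) (B ^ k) ⟩
    B ^ k + w * (e * B ^ k)    ≡⟨ cong (B ^ k +_) (*-assoc w e (B ^ k)) ⟨
    suc (w * e) * B ^ k        ≤⟨ *-monoˡ-≤ (B ^ k) (≤-<-trans (*-monoʳ-≤ w (<⇒≤pred e<c)) w[c-1]<B) ⟩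
    B * B ^ k                  ∎

  smallDigits< : ∀ k {x} → SmallDigits k x → x < B ^ k
  smallDigits< k x-digits = subst (_< B ^ k) (*-identityˡ _)
    (smallDigits-scaled< 1 (subst (_< B) (sym (*-identityˡ (pred c))) (<-≤-trans pred[c]<c c≤B)) k x-digits)
    where
    pred[c]<c : pred c < c
    pred[c]<c = m≤pred[n]⇒suc[m]≤n ≤-refl

  -- below k N: the numbers below N with k small digits, in increasing order;
  -- belowLead k N e: those with k + 1 small digits, the leading one below e.
  mutual
    below : ℕ → ℕ → List ℕ
    below zero    zero    = []
    below zero    (suc _) = 0 ∷ []
    below (suc k) N       = belowLead k N c

    belowLead : ℕ → ℕ → ℕ → List ℕ
    belowLead k N zero    = []
    belowLead k N (suc e) = belowLead k N e ++ map (e * B ^ k +_) (below k (N ∸ e * B ^ k))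

  ∈-belowLead : ∀ k {N} e {x} → x ∈ belowLead k N e →
                ∃₂ λ d y → d < e × y ∈ below k (N ∸ d * B ^ k) × x ≡ d * B ^ k + y
  ∈-belowLead k (suc e) x∈ with ∈-++⁻ (belowLead k _ e) x∈
  ... | inj₁ x∈ˡ = let d , y , d<e , y∈ , x≡ = ∈-belowLead k e x∈ˡ in d , y , m<n⇒m<1+n d<e , y∈ , x≡
  ... | inj₂ x∈ʳ = let y , y∈ , x≡ = ∈-map⁻ (e * B ^ k +_) x∈ʳ in e , y , n<1+n e , y∈ , x≡

  ∈-below : ∀ k {N x} → x ∈ below k N → x < N × SmallDigits k x
  ∈-below zero    {suc _} (here refl) = s≤s z≤n , refl
  ∈-below (suc k) {N} x∈ with ∈-belowLead k c x∈
  ... | d , y , d<c , y∈ , refl with ∈-below k y∈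
  ...   | y<N∸dBᵏ , y-digits = <∸⇒+< y<N∸dBᵏ , d , y , d<c , y-digits , refl

  belowLead< : ∀ k {N} e {x} → x ∈ belowLead k N e → x < e * B ^ k
  belowLead< k e x∈ with ∈-belowLead k e x∈
  ... | d , y , d<e , y∈ , refl = begin-strict
    d * B ^ k + y      <⟨ +-monoʳ-< (d * B ^ k) (smallDigits< k (proj₂ (∈-below k y∈))) ⟩
    d * B ^ k + B ^ k  ≡⟨ +-comm (d * B ^ k) (B ^ k) ⟩
    suc d * B ^ k      ≤⟨ *-monoˡ-≤ (B ^ k) d<e ⟩
    e * B ^ k          ∎

  mutual
    below-increasing : ∀ k N → AllPairs _<_ (below k N)
    below-increasing zero    zero    = AllPairs.[]
    below-increasing zero    (suc N) = All.[] AllPairs.∷ AllPairs.[]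
    below-increasing (suc k) N       = belowLead-increasing k N c

    belowLead-increasing : ∀ k N e → AllPairs _<_ (belowLead k N e)
    belowLead-increasing k N zero    = AllPairs.[]
    belowLead-increasing k N (suc e) = AllPairs.++⁺
      (belowLead-increasing k N e)
      (AllPairs.map⁺ (AllPairs.map (+-monoʳ-< (e * B ^ k)) (below-increasing k (N ∸ e * B ^ k))))
      (All.tabulate λ x∈ → All.tabulate λ y∈ → lead<lead x∈ y∈)
      where
      lead<lead : ∀ {x y} → x ∈ belowLead k N e → y ∈ map (e * B ^ k +_) (below k (N ∸ e * B ^ k)) → x < y
      lead<lead x∈ y∈ with ∈-map⁻ (e * B ^ k +_) y∈
      ... | z , _ , refl = <-≤-trans (belowLead< k e x∈) (m≤m+n (e * B ^ k) z)

  length-belowLead : ∀ k N e →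
    length (belowLead k N (suc e)) ≡ length (belowLead k N e) + length (below k (N ∸ e * B ^ k))
  length-belowLead k N e = trans (length-++ (belowLead k N e))
    (cong (length (belowLead k N e) +_) (length-map _ (below k (N ∸ e * B ^ k))))

  length-belowLead-mono : ∀ k N {e e′} → e ≤ e′ → length (belowLead k N e) ≤ length (belowLead k N e′)
  length-belowLead-mono k N e≤e′ = mono′ (≤⇒≤′ e≤e′)
    where
    mono′ : ∀ {e e′} → e ≤′ e′ → length (belowLead k N e) ≤ length (belowLead k N e′)
    mono′ ≤′-refl                = ≤-refl
    mono′ (≤′-step {e′} e≤′e′) = ≤-trans (mono′ e≤′e′) (begin
      length (belowLead k N e′)                                      ≤⟨ m≤m+n _ _ ⟩
      length (belowLead k N e′) + length (below k (N ∸ e′ * B ^ k))  ≡⟨ length-belowLead k N e′ ⟨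
      length (belowLead k N (suc e′))                                ∎)

  mutual
    c^k≤length-below : ∀ k {N} → B ^ k ≤ N → c ^ k ≤ length (below k N)
    c^k≤length-below zero    {suc _} _     = ≤-refl
    c^k≤length-below (suc k) {N}     Bᵏ⁺¹≤N = e*c^k≤length-belowLead k c (≤-trans (*-monoˡ-≤ (B ^ k) c≤B) Bᵏ⁺¹≤N)

    e*c^k≤length-belowLead : ∀ k {N} e → e * B ^ k ≤ N → e * c ^ k ≤ length (belowLead k N e)
    e*c^k≤length-belowLead k zero    _ = z≤n
    e*c^k≤length-belowLead k {N} (suc e) [1+e]Bᵏ≤N = begin
      c ^ k + e * c ^ k          ≡⟨ +-comm (c ^ k) (e * c ^ k) ⟩
      e * c ^ k + c ^ k          ≤⟨ +-mono-≤ (e*c^k≤length-belowLead k e (m+n≤o⇒n≤o (B ^ k) [1+e]Bᵏ≤N))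
                                             (c^k≤length-below k (m+n≤o⇒m≤o∸n (B ^ k) [1+e]Bᵏ≤N)) ⟩
      length (belowLead k N e) + length (below k (N ∸ e * B ^ k)) ≡⟨ length-belowLead k N e ⟨
      length (belowLead k N (suc e)) ∎

  below-nonempty : ∀ k {N} → 0 < N → 0 < length (below k N)
  below-nonempty zero    {suc _} _   = s≤s z≤n
  below-nonempty (suc k) {N}     0<N = begin-strict
    0                         <⟨ below-nonempty k 0<N ⟩
    length (below k N)        ≡⟨ length-belowLead k N 0 ⟨
    length (belowLead k N 1)  ≤⟨ length-belowLead-mono k N (>-nonZero⁻¹ c) ⟩
    length (belowLead k N c)  ∎

  module _ {p q} (0<p : 0 < p) (p≤q : p ≤ q) (Bᵖ≤cᵍ : B ^ p ≤ c ^ q) where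

    c*Bᵏ≤N⇒length-belowLead-^≥ : ∀ k {N} → c * B ^ k ≤ N → N ≤ B ^ suc k →
                                   N ^ p ≤ length (belowLead k N c) ^ q
    c*Bᵏ≤N⇒length-belowLead-^≥ k {N} cBᵏ≤N N≤Bᵏ⁺¹ = begin
      N ^ p                         ≤⟨ ^-monoˡ-≤ p N≤Bᵏ⁺¹ ⟩
      (B ^ suc k) ^ p               ≤⟨ ^-pres-^≤ p q (suc k) Bᵖ≤cᵍ ⟩
      (c ^ suc k) ^ q               ≤⟨ ^-monoˡ-≤ q (e*c^k≤length-belowLead k c cBᵏ≤N) ⟩
      length (belowLead k N c) ^ q  ∎

    d<c⇒length-belowLead-^≥ : ∀ k d r → d < c → r ^ p ≤ length (below k r) ^ q →
                              (d * B ^ k + r) ^ p ≤ length (belowLead k (d * B ^ k + r) c) ^ q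
    d<c⇒length-belowLead-^≥ k d r d<c rᵖ≤ = begin
      (d * B ^ k + r) ^ p                   ≤⟨ +-pres-^≤ 0<p p≤q leading rᵖ≤ ⟩
      (d * c ^ k + length (below k r)) ^ q  ≤⟨ ^-monoˡ-≤ q (begin
        d * c ^ k + length (below k r)        ≤⟨ +-monoˡ-≤ _ (e*c^k≤length-belowLead k d (m≤m+n (d * B ^ k) r)) ⟩
        length (belowLead k N d) + length (below k r)
          ≡⟨ cong (λ n → length (belowLead k N d) + length (below k n)) (m+n∸m≡n (d * B ^ k) r) ⟨
        length (belowLead k N d) + length (below k (N ∸ d * B ^ k))  ≡⟨ length-belowLead k N d ⟨
        length (belowLead k N (suc d))        ≤⟨ length-belowLead-mono k N d<c ⟩
        length (belowLead k N c)              ∎) ⟩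
      length (belowLead k N c) ^ q          ∎
      where
      N = d * B ^ k + r
      leading : (d * B ^ k) ^ p ≤ (d * c ^ k) ^ q
      leading = *-pres-^≤ p q (m^n≤m^o d 0<p p≤q) (^-pres-^≤ p q k Bᵖ≤cᵍ)

    length-belowLead-^≥ : ∀ k {N} d r → N ≡ d * B ^ k + r → N ≤ B ^ suc k →
                          r ^ p ≤ length (below k r) ^ q → N ^ p ≤ length (belowLead k N c) ^ q
    length-belowLead-^≥ k d r refl N≤Bᵏ⁺¹ rᵖ≤ with c ≤? d
    ... | yes c≤d = c*Bᵏ≤N⇒length-belowLead-^≥ k (≤-trans (*-monoˡ-≤ (B ^ k) c≤d) (m≤m+n (d * B ^ k) r)) N≤Bᵏ⁺¹
    ... | no  c≰d = d<c⇒length-belowLead-^≥ k d r (≰⇒> c≰d) rᵖ≤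

    length-below-^≥ : ∀ k {N} → N ≤ B ^ k → N ^ p ≤ length (below k N) ^ q
    length-below-^≥ zero    {0}    _        = m^n≤m^o 0 0<p p≤q
    length-below-^≥ zero    {1}    _        = ≤-reflexive (trans (^-zeroˡ p) (sym (^-zeroˡ q)))
    length-below-^≥ zero    {2+ _} (s≤s ())
    length-below-^≥ (suc k) {N} N≤Bᵏ⁺¹ = length-belowLead-^≥ k (N / B ^ k) (N % B ^ k)
      (trans (m≡m%n+[m/n]*n N (B ^ k)) (+-comm (N % B ^ k) _)) N≤Bᵏ⁺¹ (length-below-^≥ k (<⇒≤ (m%n<n N (B ^ k))))
      where
      instance
        Bᵏ-nonZero : NonZero (B ^ k)
        Bᵏ-nonZero = m^n≢0 B k

  length-below-≼ : 1 < B → ∀ k {N} → 0 < N → N ≤ B ^ k → (B , c) ≼ (N , length (below k N))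
  length-below-≼ _   k {N} 0<N _    zero      q _     =
    m^n>0 (length (below k N)) {{>-nonZero (below-nonempty k 0<N)}} q
  length-below-≼ 1<B k     _   N≤Bᵏ p@(suc _) q Bᵖ≤cᵍ =
    length-below-^≥ (s≤s z≤n) (x^p≤y^q⇒p≤q 1<B c≤B p q Bᵖ≤cᵍ) Bᵖ≤cᵍ k N≤Bᵏ

module LinearEquation where

  open import Defs
  open import Data.Nat.Base as ℕ using (ℕ; zero; suc; _≡ᵇ_; _⊔_; pred; NonZero)
  import Data.Nat.Properties as ℕ
  import Data.Nat.Divisibility as ℕ
  open import Data.Integer.Base using (ℤ; +_; 0ℤ; _+_; _*_; -_; _-_; ∣_∣)
  open import Data.Integer.Properties
  open import Data.Integer.Divisibility using (_∣_)
  open import Data.Integer.Coprimality as Coprime using (Coprime; coprime-divisor)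
  open import Data.Integer.Tactic.RingSolver using (solve-∀)
  open import Algebra.Properties.AbelianGroup +-0-abelianGroup using (inverseʳ-unique)
  open import Data.Bool.Base using (true; false)
  open import Data.Product using (_×_; _,_; proj₁; proj₂)
  open import Data.Sum using (inj₁; inj₂)
  open import Data.List using (List; map)
  open import Data.List.Membership.Propositional using (_∈_)
  open import Data.List.Membership.Propositional.Properties using (∈-map⁻)
  open import Relation.Binary.PropositionalEquality
  open import Relation.Nullary.Negation using (contradiction)
  open Powers using (base; c≤base)

  i∣i*j : ∀ i j → i ∣ i * j
  i∣i*j i j = subst (∣ i ∣ ℕ.∣_) (sym (abs-* i j)) (ℕ.m∣m*n ∣ j ∣)

  i*j+k≡0⇒i∣k : ∀ i j k → i * j + k ≡ 0ℤ → i ∣ k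
  i*j+k≡0⇒i∣k i j k ij+k≡0 = subst (i ∣_) i*-j≡k (i∣i*j i (- j))
    where i*-j≡k = trans (sym (neg-distribʳ-* i j)) (sym (inverseʳ-unique (i * j) k ij+k≡0))

  m∣n∧n<m⇒n≡0 : ∀ {m n} → m ℕ.∣ n → n < m → n ≡ 0
  m∣n∧n<m⇒n≡0 {n = zero}  _   _   = refl
  m∣n∧n<m⇒n≡0 {n = suc _} m∣n n<m = contradiction m∣n (ℕ.>⇒∤ n<m)

  i∣j∧∣j∣<∣i∣⇒j≡0 : ∀ i {j} → i ∣ j → ∣ j ∣ < ∣ i ∣ → j ≡ 0ℤ
  i∣j∧∣j∣<∣i∣⇒j≡0 _ i∣j ∣j∣<∣i∣ = ∣i∣≡0⇒i≡0 (m∣n∧n<m⇒n≡0 i∣j ∣j∣<∣i∣)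

  coprime-combination≡0 : ∀ a b u v → Coprime a b → ∣ u ∣ < ∣ b ∣ → a * u + b * v ≡ 0ℤ →
                          u ≡ 0ℤ × v ≡ 0ℤ
  coprime-combination≡0 a b u v a⊥b ∣u∣<∣b∣ au+bv≡0 = u≡0 , v≡0
    where
    b∣au : b ∣ a * u
    b∣au = i*j+k≡0⇒i∣k b v (a * u) (trans (+-comm (b * v) (a * u)) au+bv≡0)
    u≡0 : u ≡ 0ℤ
    u≡0 = i∣j∧∣j∣<∣i∣⇒j≡0 b (coprime-divisor b a u (Coprime.sym {a} {b} a⊥b) b∣au) ∣u∣<∣b∣
    bv≡0 : b * v ≡ 0ℤ
    bv≡0 = begin
      b * v          ≡⟨ +-identityˡ (b * v) ⟨
      0ℤ + b * v     ≡⟨ cong (_+ b * v) (trans (sym (*-zeroʳ a)) (cong (a *_) (sym u≡0))) ⟩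
      a * u + b * v  ≡⟨ au+bv≡0 ⟩
      0ℤ             ∎
      where open ≡-Reasoning
    v≡0 : v ≡ 0ℤ
    v≡0 with i*j≡0⇒i≡0∨j≡0 b bv≡0
    ... | inj₁ refl = contradiction ∣u∣<∣b∣ ℕ.n≮0
    ... | inj₂ v≡0  = v≡0

  n*i+j≡0⇒i≡0×j≡0 : ∀ n i j → + n * i + j ≡ 0ℤ → ∣ j ∣ < n → i ≡ 0ℤ × j ≡ 0ℤ
  n*i+j≡0⇒i≡0×j≡0 n i j ni+j≡0 ∣j∣<n = i≡0 , j≡0
    where
    j≡0 : j ≡ 0ℤ
    j≡0 = i∣j∧∣j∣<∣i∣⇒j≡0 (+ n) (i*j+k≡0⇒i∣k (+ n) i j ni+j≡0) ∣j∣<n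
    i≡0 : i ≡ 0ℤ
    i≡0 with i*j≡0⇒i≡0∨j≡0 (+ n) (trans (sym (trans (cong (λ t → + n * i + t) j≡0) (+-identityʳ _))) ni+j≡0)
    ... | inj₁ refl = contradiction ∣j∣<n ℕ.n≮0
    ... | inj₂ i≡0  = i≡0

  ∣i*j+k*l∣≤[∣i∣+∣k∣]*[∣j∣⊔∣l∣] : ∀ i j k l → ∣ i * j + k * l ∣ ≤ (∣ i ∣ ℕ.+ ∣ k ∣) ℕ.* (∣ j ∣ ⊔ ∣ l ∣)
  ∣i*j+k*l∣≤[∣i∣+∣k∣]*[∣j∣⊔∣l∣] i j k l = begin
    ∣ i * j + k * l ∣                    ≤⟨ ∣i+j∣≤∣i∣+∣j∣ (i * j) (k * l) ⟩
    ∣ i * j ∣ ℕ.+ ∣ k * l ∣              ≡⟨ cong₂ ℕ._+_ (abs-* i j) (abs-* k l) ⟩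
    ∣ i ∣ ℕ.* ∣ j ∣ ℕ.+ ∣ k ∣ ℕ.* ∣ l ∣  ≤⟨ ℕ.+-mono-≤ (ℕ.*-monoʳ-≤ ∣ i ∣ (ℕ.m≤m⊔n ∣ j ∣ ∣ l ∣))
                                                        (ℕ.*-monoʳ-≤ ∣ k ∣ (ℕ.m≤n⊔m ∣ j ∣ ∣ l ∣)) ⟩
    ∣ i ∣ ℕ.* M ℕ.+ ∣ k ∣ ℕ.* M          ≡⟨ ℕ.*-distribʳ-+ M ∣ i ∣ ∣ k ∣ ⟨
    (∣ i ∣ ℕ.+ ∣ k ∣) ℕ.* M              ∎
    where
    open ℕ.≤-Reasoning
    M = ∣ j ∣ ⊔ ∣ l ∣

  ∣+m-+n∣≤m⊔n : ∀ m n → ∣ + m - + n ∣ ≤ m ⊔ n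
  ∣+m-+n∣≤m⊔n m n = subst (λ i → ∣ i ∣ ≤ m ⊔ n) (sym (m-n≡m⊖n m n)) (∣m⊝n∣≤m⊔n m n)

  +m-+n≡0⇒m≡n : ∀ m n → + m - + n ≡ 0ℤ → m ≡ n
  +m-+n≡0⇒m≡n m n m-n≡0 = +-injective (i-j≡0⇒i≡j (+ m) (+ n) m-n≡0)

  isSolution⇒combination≡0 : ∀ a b x₁ x₂ x₁′ x₂′ → IsSolution a b x₁ x₂ x₁′ x₂′ →
                             a * (+ x₁ - + x₁′) + b * (+ x₂ - + x₂′) ≡ 0ℤ
  isSolution⇒combination≡0 a b x₁ x₂ x₁′ x₂′ sol =
    trans (difference a b (+ x₁) (+ x₂) (+ x₁′) (+ x₂′)) (i≡j⇒i-j≡0 sol)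
    where
    difference : ∀ a b X₁ X₂ X₁′ X₂′ →
                 a * (X₁ - X₁′) + b * (X₂ - X₂′) ≡ (a * X₁ + b * X₂) - (a * X₁′ + b * X₂′)
    difference = solve-∀

  isSolution-suc⁻ : ∀ a b x₁ x₂ x₁′ x₂′ → IsSolution a b (suc x₁) (suc x₂) (suc x₁′) (suc x₂′) →
                    IsSolution a b x₁ x₂ x₁′ x₂′
  isSolution-suc⁻ a b x₁ x₂ x₁′ x₂′ sol = begin
    a * + x₁ + b * + x₂                                          ≡⟨ unshift a b (+ x₁) (+ x₂) ⟩
    (a * (+ 1 + + x₁) + b * (+ 1 + + x₂)) - (a + b)              ≡⟨ cong (_- (a + b)) sol ⟩
    (a * (+ 1 + + x₁′) + b * (+ 1 + + x₂′)) - (a + b)            ≡⟨ unshift a b (+ x₁′) (+ x₂′) ⟨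
    a * + x₁′ + b * + x₂′                                        ∎
    where
    open ≡-Reasoning
    unshift : ∀ a b X₁ X₂ → a * X₁ + b * X₂ ≡ (a * (+ 1 + X₁) + b * (+ 1 + X₂)) - (a + b)
    unshift = solve-∀

  coeffAt-cancel : ∀ i x α → coeffAt i x α + coeffAt (- i) x α ≡ 0ℤ
  coeffAt-cancel i x α with x ≡ᵇ α
  ... | true  = +-inverseʳ i
  ... | false = refl

  coeffAt-0 : ∀ x α → coeffAt 0ℤ x α ≡ 0ℤ
  coeffAt-0 x α with x ≡ᵇ α
  ... | true  = refl
  ... | false = refl

  trivial-x₂≡x₂′ : ∀ a b x₁ x₂ x₁′ → (∀ α → coeffAt a x₁ α + coeffAt (- a) x₁′ α ≡ 0ℤ) →
                   Trivial a b x₁ x₂ x₁′ x₂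
  trivial-x₂≡x₂′ a b x₁ x₂ x₁′ x₁-cancels α = begin
    coeffAt a x₁ α + coeffAt b x₂ α + coeffAt (- a) x₁′ α + coeffAt (- b) x₂ α
      ≡⟨ regroup (coeffAt a x₁ α) (coeffAt b x₂ α) (coeffAt (- a) x₁′ α) (coeffAt (- b) x₂ α) ⟩
    (coeffAt a x₁ α + coeffAt (- a) x₁′ α) + (coeffAt b x₂ α + coeffAt (- b) x₂ α)
      ≡⟨ cong₂ _+_ (x₁-cancels α) (coeffAt-cancel b x₂ α) ⟩
    0ℤ ∎
    where
    open ≡-Reasoning
    regroup : ∀ w x y z → w + x + y + z ≡ (w + y) + (x + z)
    regroup = solve-∀

  trivial-diagonal : ∀ a b x₁ x₂ → Trivial a b x₁ x₂ x₁ x₂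
  trivial-diagonal a b x₁ x₂ = trivial-x₂≡x₂′ a b x₁ x₂ x₁ (coeffAt-cancel a x₁)

  trivial-0 : ∀ b x₁ x₂ x₁′ → Trivial 0ℤ b x₁ x₂ x₁′ x₂
  trivial-0 b x₁ x₂ x₁′ = trivial-x₂≡x₂′ 0ℤ b x₁ x₂ x₁′ λ α → cong₂ _+_ (coeffAt-0 x₁ α) (coeffAt-0 x₁′ α)

  trivial-suc : ∀ a b x₁ x₂ x₁′ x₂′ → Trivial a b x₁ x₂ x₁′ x₂′ → Trivial a b (suc x₁) (suc x₂) (suc x₁′) (suc x₂′)
  trivial-suc _ _ _ _ _ _ trivial zero    = refl
  trivial-suc _ _ _ _ _ _ trivial (suc α) = trivial α

  TrivialOnly : ℤ → ℤ → List ℕ → Set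
  TrivialOnly a b A = ∀ x₁ x₂ x₁′ x₂′ → x₁ ∈ A → x₂ ∈ A → x₁′ ∈ A → x₂′ ∈ A →
                      IsSolution a b x₁ x₂ x₁′ x₂′ → Trivial a b x₁ x₂ x₁′ x₂′

  trivialOnly-map-suc : ∀ {a b L} → TrivialOnly a b L → TrivialOnly a b (map suc L)
  trivialOnly-map-suc {a} {b} trivialOnly _ _ _ _ x₁∈ x₂∈ x₁′∈ x₂′∈ sol
    with ∈-map⁻ suc x₁∈ | ∈-map⁻ suc x₂∈ | ∈-map⁻ suc x₁′∈ | ∈-map⁻ suc x₂′∈
  ... | y₁ , y₁∈ , refl | y₂ , y₂∈ , refl | y₁′ , y₁′∈ , refl | y₂′ , y₂′∈ , refl =
    trivial-suc a b y₁ y₂ y₁′ y₂′ (trivialOnly y₁ y₂ y₁′ y₂′ y₁∈ y₂∈ y₁′∈ y₂′∈ (isSolution-suc⁻ a b y₁ y₂ y₁′ y₂′ sol))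

  trivialOnly-0 : ∀ {b} → b ≢ 0ℤ → ∀ L → TrivialOnly 0ℤ b L
  trivialOnly-0 {b} b≢0 _ x₁ x₂ x₁′ x₂′ _ _ _ _ sol
    with i*j≡0⇒i≡0∨j≡0 b (trans (sym (+-identityˡ _)) (isSolution⇒combination≡0 0ℤ b x₁ x₂ x₁′ x₂′ sol))
  ... | inj₁ b≡0       = contradiction b≡0 b≢0
  ... | inj₂ x₂-x₂′≡0 with +m-+n≡0⇒m≡n x₂ x₂′ x₂-x₂′≡0
  ...   | refl = trivial-0 b x₁ x₂ x₁′

  module _ (a b : ℤ) (a⊥b : Coprime a b) (∣a∣<∣b∣ : ∣ a ∣ < ∣ b ∣) where

    private
      c = ∣ b ∣
      instance
        c-nonZero : NonZero c
        c-nonZero = ℕ.>-nonZero (ℕ.m<n⇒0<n ∣a∣<∣b∣)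

    open Digits c (base c) (c≤base c)

    digit-difference< : ∀ {e e′} → e < c → e′ < c → ∣ + e - + e′ ∣ < c
    digit-difference< {e} {e′} e<c e′<c = ℕ.≤-<-trans (∣+m-+n∣≤m⊔n e e′) (ℕ.⊔-pres-<m e<c e′<c)

    ∣combination∣<Bᵏ : ∀ k {y₁ y₂ y₁′ y₂′} →
                       SmallDigits k y₁ → SmallDigits k y₂ → SmallDigits k y₁′ → SmallDigits k y₂′ →
                       ∣ a * (+ y₁ - + y₁′) + b * (+ y₂ - + y₂′) ∣ < base c ^ k
    ∣combination∣<Bᵏ k {y₁} {y₂} {y₁′} {y₂′} d₁ d₂ d₁′ d₂′ = begin-strict
      ∣ a * (+ y₁ - + y₁′) + b * (+ y₂ - + y₂′) ∣
        ≤⟨ ∣i*j+k*l∣≤[∣i∣+∣k∣]*[∣j∣⊔∣l∣] a (+ y₁ - + y₁′) b (+ y₂ - + y₂′) ⟩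
      (∣ a ∣ ℕ.+ c) ℕ.* (∣ + y₁ - + y₁′ ∣ ⊔ ∣ + y₂ - + y₂′ ∣)
        ≤⟨ ℕ.*-mono-≤ (ℕ.+-monoˡ-≤ c (ℕ.<⇒≤pred ∣a∣<∣b∣)) (ℕ.⊔-mono-≤ (∣+m-+n∣≤m⊔n y₁ y₁′) (∣+m-+n∣≤m⊔n y₂ y₂′)) ⟩
      w ℕ.* ((y₁ ⊔ y₁′) ⊔ (y₂ ⊔ y₂′))
        <⟨ w*⊔< (w*⊔< (scaled d₁) (scaled d₁′)) (w*⊔< (scaled d₂) (scaled d₂′)) ⟩
      base c ^ k ∎
      where
      open ℕ.≤-Reasoning
      w = pred c ℕ.+ c
      scaled : ∀ {y} → SmallDigits k y → w ℕ.* y < base c ^ k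
      scaled = smallDigits-scaled< w ℕ.≤-refl k
      w*⊔< : ∀ {m n} → w ℕ.* m < base c ^ k → w ℕ.* n < base c ^ k → w ℕ.* (m ⊔ n) < base c ^ k
      w*⊔< {m} {n} wm< wn< = subst (_< base c ^ k) (sym (ℕ.*-distribˡ-⊔ w m n)) (ℕ.⊔-pres-<m wm< wn<)

    combination-split : ∀ P e₁ e₂ e₁′ e₂′ y₁ y₂ y₁′ y₂′ →
      a * (+ (e₁ ℕ.* P ℕ.+ y₁) - + (e₁′ ℕ.* P ℕ.+ y₁′)) + b * (+ (e₂ ℕ.* P ℕ.+ y₂) - + (e₂′ ℕ.* P ℕ.+ y₂′))
      ≡ + P * (a * (+ e₁ - + e₁′) + b * (+ e₂ - + e₂′)) + (a * (+ y₁ - + y₁′) + b * (+ y₂ - + y₂′))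
    combination-split P e₁ e₂ e₁′ e₂′ y₁ y₂ y₁′ y₂′ =
      trans (cong₂ (λ s t → a * s + b * t) (cong₂ _-_ (pos e₁ y₁) (pos e₁′ y₁′)) (cong₂ _-_ (pos e₂ y₂) (pos e₂′ y₂′)))
            (ring a b (+ P) (+ e₁) (+ e₂) (+ e₁′) (+ e₂′) (+ y₁) (+ y₂) (+ y₁′) (+ y₂′))
      where
      pos : ∀ e y → + (e ℕ.* P ℕ.+ y) ≡ + e * + P + + y
      pos e y = trans (pos-+ (e ℕ.* P) y) (cong (_+ + y) (pos-* e P))
      ring : ∀ a b P E₁ E₂ E₁′ E₂′ Y₁ Y₂ Y₁′ Y₂′ →
        a * ((E₁ * P + Y₁) - (E₁′ * P + Y₁′)) + b * ((E₂ * P + Y₂) - (E₂′ * P + Y₂′))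
        ≡ P * (a * (E₁ - E₁′) + b * (E₂ - E₂′)) + (a * (Y₁ - Y₁′) + b * (Y₂ - Y₂′))
      ring = solve-∀

    combination≡0⇒≡ : ∀ k {x₁ x₂ x₁′ x₂′} →
                      SmallDigits k x₁ → SmallDigits k x₂ → SmallDigits k x₁′ → SmallDigits k x₂′ →
                      a * (+ x₁ - + x₁′) + b * (+ x₂ - + x₂′) ≡ 0ℤ → x₁ ≡ x₁′ × x₂ ≡ x₂′
    combination≡0⇒≡ zero refl refl refl refl _ = refl , refl
    combination≡0⇒≡ (suc k) (e₁ , y₁ , e₁<c , d₁ , refl) (e₂ , y₂ , e₂<c , d₂ , refl)
                            (e₁′ , y₁′ , e₁′<c , d₁′ , refl) (e₂′ , y₂′ , e₂′<c , d₂′ , refl) combination≡0 =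
      cong₂ digits (+m-+n≡0⇒m≡n e₁ e₁′ (proj₁ leading-digits≡)) (proj₁ rests≡) ,
      cong₂ digits (+m-+n≡0⇒m≡n e₂ e₂′ (proj₂ leading-digits≡)) (proj₂ rests≡)
      where
      P = base c ^ k
      digits : ℕ → ℕ → ℕ
      digits e y = e ℕ.* P ℕ.+ y
      leading = a * (+ e₁ - + e₁′) + b * (+ e₂ - + e₂′)
      rest = a * (+ y₁ - + y₁′) + b * (+ y₂ - + y₂′)
      leading≡0×rest≡0 : leading ≡ 0ℤ × rest ≡ 0ℤ
      leading≡0×rest≡0 = n*i+j≡0⇒i≡0×j≡0 P leading rest
        (trans (sym (combination-split P e₁ e₂ e₁′ e₂′ y₁ y₂ y₁′ y₂′)) combination≡0)
        (∣combination∣<Bᵏ k d₁ d₂ d₁′ d₂′)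
      leading-digits≡ : + e₁ - + e₁′ ≡ 0ℤ × + e₂ - + e₂′ ≡ 0ℤ
      leading-digits≡ = coprime-combination≡0 a b (+ e₁ - + e₁′) (+ e₂ - + e₂′) a⊥b
        (digit-difference< e₁<c e₁′<c) (proj₁ leading≡0×rest≡0)
      rests≡ : y₁ ≡ y₁′ × y₂ ≡ y₂′
      rests≡ = combination≡0⇒≡ k d₁ d₂ d₁′ d₂′ (proj₂ leading≡0×rest≡0)

    below-trivialOnly : ∀ k N → TrivialOnly a b (below k N)
    below-trivialOnly k N x₁ x₂ x₁′ x₂′ x₁∈ x₂∈ x₁′∈ x₂′∈ sol
      with combination≡0⇒≡ k (proj₂ (∈-below k x₁∈)) (proj₂ (∈-below k x₂∈))
                             (proj₂ (∈-below k x₁′∈)) (proj₂ (∈-below k x₂′∈))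
                             (isSolution⇒combination≡0 a b x₁ x₂ x₁′ x₂′ sol)
    ... | refl , refl = trivial-diagonal a b x₁ x₂

open Powers using (_≼_; ≼-trans; x^p≤y^q⇒p≤q; n<m^n; base; c≤base; 56/6≼base)
open LinearEquation using (TrivialOnly; trivialOnly-map-suc; trivialOnly-0; below-trivialOnly)
open import Data.Nat.Base using (suc; z≤n; s≤s; >-nonZero)
open import Data.Nat.Properties
  using (≤-trans; <-≤-trans; ≤-pred; ≰⇒>; <⇒≤; <⇒≢; n≮0; n<1⇒n≡0; suc-injective; ^-monoʳ-≤; m≤m+n; _≤?_)
open import Data.Integer.Base using (0ℤ)
open import Data.Integer.Properties using (∣i∣≡0⇒i≡0)
open import Data.Product using (_,_; proj₁)
open import Data.List using (map; upTo)
open import Data.List.Properties using (length-map; length-upTo)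
open import Data.List.Membership.Propositional.Properties using (∈-upTo⁻)
import Data.List.Relation.Unary.All as All
import Data.List.Relation.Unary.All.Properties as All
import Data.List.Relation.Unary.AllPairs as AllPairs
import Data.List.Relation.Unary.Unique.Propositional.Properties as Unique
open import Relation.Binary.PropositionalEquality using (_≢_; refl; sym; subst)
open import Relation.Nullary using (yes; no)

SolutionFreeBelow : ℤ → ℤ → ℕ → Set
SolutionFreeBelow a b N =
  Σ (List ℕ) λ L → Unique L × All (_< N) L × (56 , 6) ≼ (N , length L) × TrivialOnly a b L

digits-solutionFree : ∀ a b N → Coprime a b → ∣ a ∣ < ∣ b ∣ → 2 ≤ ∣ b ∣ → 0 < N → SolutionFreeBelow a b N
digits-solutionFree a b N a⊥b ∣a∣<∣b∣ 2≤c 0<N =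
  below N N ,
  AllPairs.map <⇒≢ (below-increasing N N) ,
  All.tabulate (λ x∈ → proj₁ (∈-below N x∈)) ,
  ≼-trans (56/6≼base c 2≤c) (length-below-≼ 1<B N 0<N (<⇒≤ (n<m^n N 1<B))) ,
  below-trivialOnly a b a⊥b ∣a∣<∣b∣ N N
  where
  c = ∣ b ∣
  instance
    c-nonZero : NonZero c
    c-nonZero = >-nonZero (≤-trans (s≤s z≤n) 2≤c)
  open Digits c (base c) (c≤base c)
  1<B : 1 < base c
  1<B = <-≤-trans 2≤c (c≤base c)

upTo-solutionFree : ∀ b N → b ≢ 0ℤ → 0 < N → SolutionFreeBelow 0ℤ b N
upTo-solutionFree b N b≢0 0<N =
  upTo N , Unique.upTo⁺ N , All.tabulate ∈-upTo⁻ , N≼N , trivialOnly-0 b≢0 (upTo N)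
  where
  N≼N : (56 , 6) ≼ (N , length (upTo N))
  N≼N p q 56ᵖ≤6ᵍ = subst (λ L → N ^ p ≤ L ^ q) (sym (length-upTo N))
    (^-monoʳ-≤ N {{>-nonZero 0<N}} (x^p≤y^q⇒p≤q (s≤s (s≤s z≤n)) (m≤m+n 6 50) p q 56ᵖ≤6ᵍ))

map-suc-solutionFree : ∀ a b N → SolutionFreeBelow a b N →
  Σ (List ℕ) λ A → Unique A × All (λ x → 1 ≤ x × x ≤ N) A ×
    (∀ p q → 0 < q → 56 ^ p ≤ 6 ^ q → N ^ p ≤ length A ^ q) × TrivialOnly a b A
map-suc-solutionFree a b N (L , L-unique , L<N , L-large , L-trivialOnly) =
  map suc L ,
  Unique.map⁺ suc-injective L-unique ,
  All.map⁺ (All.map (λ x<N → s≤s z≤n , x<N) L<N) ,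
  (λ p q _ 56ᵖ≤6ᵍ → subst (λ n → N ^ p ≤ n ^ q) (sym (length-map suc L)) (L-large p q 56ᵖ≤6ᵍ)) ,
  trivialOnly-map-suc {a} {b} {L} L-trivialOnly

corollary6 : (a b : ℤ) → Coprime a b → ∣ a ∣ < ∣ b ∣ → (N : ℕ) → 0 < N →
    Σ (List ℕ) λ A →
      Unique A
      × All (λ x → 1 ≤ x × x ≤ N) A
      × (∀ (p q : ℕ) → 0 < q → 56 ^ p ≤ 6 ^ q → N ^ p ≤ length A ^ q)
      × (∀ x₁ x₂ x₁' x₂' → x₁ ∈ A → x₂ ∈ A → x₁' ∈ A → x₂' ∈ A →
           IsSolution a b x₁ x₂ x₁' x₂' → Trivial a b x₁ x₂ x₁' x₂')
corollary6 a b a⊥b ∣a∣<∣b∣ N 0<N with 2 ≤? ∣ b ∣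
... | yes 2≤∣b∣ = map-suc-solutionFree a b N (digits-solutionFree a b N a⊥b ∣a∣<∣b∣ 2≤∣b∣ 0<N)
... | no  2≰∣b∣ with ∣i∣≡0⇒i≡0 {a} (n<1⇒n≡0 (<-≤-trans ∣a∣<∣b∣ (≤-pred (≰⇒> 2≰∣b∣))))
...   | refl = map-suc-solutionFree 0ℤ b N (upTo-solutionFree b N b≢0 0<N)
  where
  b≢0 : b ≢ 0ℤ
  b≢0 refl = n≮0 ∣a∣<∣b∣
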